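{- Let $(x_n^t)_{n\in\mathbb{Z},\,t\ge 0}$ be the rule 150 elementary cellular automaton started from a single seed ($x_n^0=1$ if $n=0$, $x_n^0=0$ otherwise, and $x_n^{t+1}=(x_{n-1}^t+x_n^t+x_{n+1}^t)\bmod 2$), let $X(t)=\sum_{n\in\mathbb{Z}}x_n^t$, and let $S_n=\sum_{i=0}^{2^n-1}X(i)$ for $n\ge 0$. Then $S_0=1$, $S_1=4$, and for all $n\ge 2$, $$S_n=2S_{n-1}+4S_{n-2}.$$ -}

module Defs where

open import Data.Nat using (ℕ; zero; suc; _+_; _*_; _^_; _%_)
open import Data.Integer as ℤ using (ℤ; +_; -[1+_])

x : ℤ → ℕ → ℕ
x n zero with n
... | + zero = 1
... | _      = 0
x n (suc t) = (x (n ℤ.- ℤ.1ℤ) t + x n t + x (n ℤ.+ ℤ.1ℤ) t) % 2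

sumTo : ℕ → (ℕ → ℕ) → ℕ
sumTo zero    f = 0
sumTo (suc m) f = sumTo m f + f m

-- Cells outside [-t, t] are 0 at time t (light cone
-- of a radius-1 rule from a seed at 0), so the sum over ℤ equals the finite
-- sum over n = -t, …, t, written as Σ_{k=0}^{2t} x_{k-t}^t.
X : ℕ → ℕ
X t = sumTo (suc (2 * t)) (λ k → x ((+ k) ℤ.- (+ t)) t)

S : ℕ → ℕ
S n = sumTo (2 ^ n) X

{-# OPTIONS --safe #-}
module Submission where

-- Write g ⋈ h (the f of Interleaves f g h) for the configuration with g k at cell 2k and h k
-- at cell 2k + 1, and Δ g k = g k + g (k + 1) mod 2.  If the row at time 2t is x^t ⋈ 0, one step
-- of rule 150 gives x^t ⋈ Δ x^t at time 2t + 1, and a second step gives x^(t+1) ⋈ 0; so by induction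
-- from the seed, X(2t) = X(t) and X(2t+1) = X(t) + B(t), where B(t) = Σₖ Δ x^t k.
-- Likewise Δ(x^t ⋈ 0) = x^t ⋈ x^t(· + 1) and Δ(x^t ⋈ Δ x^t) = x^t(· + 1) ⋈ x^t, hence
-- B(2t) = B(2t+1) = 2 X(t).  Splitting the range 0 … 2^(n+1) - 1 by parity then gives
-- S(n+1) = 2 S(n) + U(n) and U(n+1) = 4 S(n) for U(n) = Σ_{i<2^n} B(i).

open import Defs
open import Data.Nat using (ℕ; zero; suc; _+_; _*_; _^_; _%_; _≤_; _<_; s≤s⁻¹)
open import Data.Nat.Properties
  using (+-suc; +-assoc; +-identityʳ; +-cancelʳ-≡; +-comm; <⇒≤; n<1+n; m<n⇒m<1+n; m≤m+n; ≤-trans; ≤-reflexive)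
open import Data.Nat.DivMod using (%-distribˡ-+; m%n%n≡m%n; [m+kn]%n≡m%n; m*n%n≡0)
open import Data.Nat.Tactic.RingSolver as ℕ-Solver using ()
open import Data.Integer as ℤ using (ℤ; +_; -[1+_]; 1ℤ; ∣_∣)
open import Data.Integer.Properties as ℤ using (∣i-j∣≤∣i∣+∣j∣)
open import Data.Integer.Tactic.RingSolver using (solve-∀)
open import Data.Product using (_×_; _,_)
open import Function using (const)
open import Relation.Binary.PropositionalEquality

open ≡-Reasoning

double : ℕ → ℕ
double zero    = zero
double (suc n) = suc (suc (double n))

double≡n+n : ∀ n → double n ≡ n + n
double≡n+n zero    = refl
double≡n+n (suc n) = cong suc (trans (cong suc (double≡n+n n)) (sym (+-suc n n)))

double≡2*n : ∀ n → double n ≡ 2 * n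
double≡2*n n = trans (double≡n+n n) (cong (λ m → n + m) (sym (+-identityʳ n)))

sumTo-cong : ∀ m {f g : ℕ → ℕ} → (∀ i → f i ≡ g i) → sumTo m f ≡ sumTo m g
sumTo-cong zero    f≗g = refl
sumTo-cong (suc m) f≗g = cong₂ _+_ (sumTo-cong m f≗g) (f≗g m)

sumTo-zero : ∀ m → sumTo m (const 0) ≡ 0
sumTo-zero zero    = refl
sumTo-zero (suc m) = trans (+-identityʳ _) (sumTo-zero m)

sumTo-+ : ∀ m (f g : ℕ → ℕ) → sumTo m (λ i → f i + g i) ≡ sumTo m f + sumTo m g
sumTo-+ zero    f g = refl
sumTo-+ (suc m) f g =
  trans (cong (_+ (f m + g m)) (sumTo-+ m f g)) (interchange (sumTo m f) (sumTo m g) (f m) (g m))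
  where
  interchange : ∀ a b c d → a + b + (c + d) ≡ a + c + (b + d)
  interchange = ℕ-Solver.solve-∀

sumTo-shift : ∀ m (f : ℕ → ℕ) → sumTo (suc m) f ≡ f 0 + sumTo m (λ i → f (suc i))
sumTo-shift zero    f = +-comm 0 (f 0)
sumTo-shift (suc m) f = trans (cong (_+ f (suc m)) (sumTo-shift m f)) (+-assoc (f 0) _ _)

sumTo-double : ∀ m (f : ℕ → ℕ) →
  sumTo (double m) f ≡ sumTo m (λ i → f (double i)) + sumTo m (λ i → f (suc (double i)))
sumTo-double zero    f = refl
sumTo-double (suc m) f =
  trans (cong (λ s → s + f (double m) + f (suc (double m))) (sumTo-double m f))
        (interchange (sumTo m (λ i → f (double i))) (sumTo m (λ i → f (suc (double i))))
                     (f (double m)) (f (suc (double m))))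
  where
  interchange : ∀ a b c d → a + b + c + d ≡ a + c + (b + d)
  interchange = ℕ-Solver.solve-∀

[m%2+n]%2≡[m+n]%2 : ∀ m n → (m % 2 + n) % 2 ≡ (m + n) % 2
[m%2+n]%2≡[m+n]%2 m n = begin
  (m % 2 + n) % 2          ≡⟨ %-distribˡ-+ (m % 2) n 2 ⟩
  (m % 2 % 2 + n % 2) % 2  ≡⟨ cong (λ a → (a + n % 2) % 2) (m%n%n≡m%n m 2) ⟩
  (m % 2 + n % 2) % 2      ≡⟨ %-distribˡ-+ m n 2 ⟨
  (m + n) % 2              ∎

[m+n%2]%2≡[m+n]%2 : ∀ m n → (m + n % 2) % 2 ≡ (m + n) % 2
[m+n%2]%2≡[m+n]%2 m n = begin
  (m + n % 2) % 2          ≡⟨ cong (_% 2) (+-comm m (n % 2)) ⟩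
  (n % 2 + m) % 2          ≡⟨ [m%2+n]%2≡[m+n]%2 n m ⟩
  (n + m) % 2              ≡⟨ cong (_% 2) (+-comm n m) ⟩
  (m + n) % 2              ∎

[m+[m+n]%2]%2≡n%2 : ∀ m n → (m + (m + n) % 2) % 2 ≡ n % 2
[m+[m+n]%2]%2≡n%2 m n = begin
  (m + (m + n) % 2) % 2  ≡⟨ [m+n%2]%2≡[m+n]%2 m (m + n) ⟩
  (m + (m + n)) % 2      ≡⟨ cong (_% 2) (rearrange m n) ⟩
  (n + m * 2) % 2        ≡⟨ [m+kn]%n≡m%n n m 2 ⟩
  n % 2                  ∎
  where
  rearrange : ∀ m n → m + (m + n) ≡ n + m * 2
  rearrange = ℕ-Solver.solve-∀

[[m+n]%2+n]%2≡m%2 : ∀ m n → ((m + n) % 2 + n) % 2 ≡ m % 2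
[[m+n]%2+n]%2≡m%2 m n = begin
  ((m + n) % 2 + n) % 2  ≡⟨ [m%2+n]%2≡[m+n]%2 (m + n) n ⟩
  (m + n + n) % 2        ≡⟨ cong (_% 2) (rearrange m n) ⟩
  (m + n * 2) % 2        ≡⟨ [m+kn]%n≡m%n m n 2 ⟩
  m % 2                  ∎
  where
  rearrange : ∀ m n → m + n + n ≡ m + n * 2
  rearrange = ℕ-Solver.solve-∀

[[l+m]%2+m+[m+n]%2]%2≡[l+m+n]%2 : ∀ l m n → ((l + m) % 2 + m + (m + n) % 2) % 2 ≡ (l + m + n) % 2
[[l+m]%2+m+[m+n]%2]%2≡[l+m+n]%2 l m n = begin
  ((l + m) % 2 + m + (m + n) % 2) % 2  ≡⟨ [m+n%2]%2≡[m+n]%2 ((l + m) % 2 + m) (m + n) ⟩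
  ((l + m) % 2 + m + (m + n)) % 2      ≡⟨ cong (_% 2) (+-assoc ((l + m) % 2) m (m + n)) ⟩
  ((l + m) % 2 + (m + (m + n))) % 2    ≡⟨ [m%2+n]%2≡[m+n]%2 (l + m) (m + (m + n)) ⟩
  (l + m + (m + (m + n))) % 2          ≡⟨ cong (_% 2) (rearrange l m n) ⟩
  (l + m + n + m * 2) % 2              ≡⟨ [m+kn]%n≡m%n (l + m + n) m 2 ⟩
  (l + m + n) % 2                      ∎
  where
  rearrange : ∀ l m n → l + m + (m + (m + n)) ≡ l + m + n + m * 2
  rearrange = ℕ-Solver.solve-∀

[m+[m+n]%2+n]%2≡0 : ∀ m n → (m + (m + n) % 2 + n) % 2 ≡ 0
[m+[m+n]%2+n]%2≡0 m n = begin
  (m + (m + n) % 2 + n) % 2  ≡⟨ cong (_% 2) (rearrange m ((m + n) % 2) n) ⟩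
  ((m + n) % 2 + (m + n)) % 2  ≡⟨ [m%2+n]%2≡[m+n]%2 (m + n) (m + n) ⟩
  (m + n + (m + n)) % 2      ≡⟨ cong (_% 2) (a+a≡a*2 (m + n)) ⟩
  ((m + n) * 2) % 2          ≡⟨ m*n%n≡0 (m + n) 2 ⟩
  0                          ∎
  where
  rearrange : ∀ a b c → a + b + c ≡ b + (a + c)
  rearrange = ℕ-Solver.solve-∀
  a+a≡a*2 : ∀ a → a + a ≡ a * 2
  a+a≡a*2 = ℕ-Solver.solve-∀

twice : ℤ → ℤ
twice k = k ℤ.+ k

twice+1 : ℤ → ℤ
twice+1 k = 1ℤ ℤ.+ twice k

+double : ∀ n → + double n ≡ twice (+ n)
+double n = cong +_ (double≡n+n n)

+double-+n : ∀ n → + double n ℤ.- + n ≡ + n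
+double-+n n = trans (cong (ℤ._- + n) (+double n)) (cancel (+ n))
  where
  cancel : ∀ a → a ℤ.+ a ℤ.- a ≡ a
  cancel = solve-∀

twice-suc : ∀ k → twice k ℤ.+ 1ℤ ≡ twice+1 k
twice-suc k = ℤ.+-comm (twice k) 1ℤ

twice-pred : ∀ k → twice k ℤ.- 1ℤ ≡ twice+1 (k ℤ.- 1ℤ)
twice-pred = expanded
  where
  -- The ring solver does not unfold twice and twice+1, so the identity is stated unfolded.
  expanded : ∀ k → k ℤ.+ k ℤ.- 1ℤ ≡ 1ℤ ℤ.+ (k ℤ.- 1ℤ ℤ.+ (k ℤ.- 1ℤ))
  expanded = solve-∀

twice+1-pred : ∀ k → twice+1 k ℤ.- 1ℤ ≡ twice k
twice+1-pred = expanded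
  where
  expanded : ∀ k → 1ℤ ℤ.+ (k ℤ.+ k) ℤ.- 1ℤ ≡ k ℤ.+ k
  expanded = solve-∀

twice+1-suc : ∀ k → twice+1 k ℤ.+ 1ℤ ≡ twice (k ℤ.+ 1ℤ)
twice+1-suc = expanded
  where
  expanded : ∀ k → 1ℤ ℤ.+ (k ℤ.+ k) ℤ.+ 1ℤ ≡ k ℤ.+ 1ℤ ℤ.+ (k ℤ.+ 1ℤ)
  expanded = solve-∀

window : ℕ → (ℤ → ℕ) → ℕ
window N f = sumTo (double N) (λ i → f (+ i ℤ.- + N))

window-suc : ∀ N f → window (suc N) f ≡ f -[1+ N ] + window N f + f (+ N)
window-suc N f = begin
  window (suc N) f
    ≡⟨ sumTo-shift (suc (double N)) g ⟩
  g 0 + sumTo (suc (double N)) (λ i → g (suc i))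
    ≡⟨ cong (λ a → g 0 + a) (sumTo-cong (suc (double N)) (λ i → cong f (inner (+ i) (+ N)))) ⟩
  f -[1+ N ] + (window N f + f (+ double N ℤ.- + N))
    ≡⟨ cong (λ a → f -[1+ N ] + (window N f + f a)) (+double-+n N) ⟩
  f -[1+ N ] + (window N f + f (+ N))
    ≡⟨ +-assoc (f -[1+ N ]) (window N f) (f (+ N)) ⟨
  f -[1+ N ] + window N f + f (+ N) ∎
  where
  g : ℕ → ℕ
  g i = f (+ i ℤ.- + suc N)
  inner : ∀ a b → 1ℤ ℤ.+ a ℤ.- (1ℤ ℤ.+ b) ≡ a ℤ.- b
  inner = solve-∀

window-extend : ∀ N f → f -[1+ N ] ≡ 0 → f (+ N) ≡ 0 → window (suc N) f ≡ window N f
window-extend N f left≡0 right≡0 = begin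
  window (suc N) f                   ≡⟨ window-suc N f ⟩
  f -[1+ N ] + window N f + f (+ N)  ≡⟨ cong₂ (λ a b → a + window N f + b) left≡0 right≡0 ⟩
  window N f + 0                     ≡⟨ +-identityʳ (window N f) ⟩
  window N f                         ∎

window-shift : ∀ N f → f (ℤ.- + N) ≡ f (+ N) → window N (λ k → f (k ℤ.+ 1ℤ)) ≡ window N f
window-shift N f ends = +-cancelʳ-≡ (g 0) _ _ (begin
  window N (λ k → f (k ℤ.+ 1ℤ)) + g 0
    ≡⟨ cong (_+ g 0) (sumTo-cong (double N) (λ i → cong f (inner (+ i) (+ N)))) ⟩
  sumTo (double N) (λ i → g (suc i)) + g 0
    ≡⟨ +-comm _ (g 0) ⟩
  g 0 + sumTo (double N) (λ i → g (suc i))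
    ≡⟨ sumTo-shift (double N) g ⟨
  window N f + g (double N)
    ≡⟨ cong (λ a → window N f + a) g-ends ⟩
  window N f + g 0 ∎)
  where
  g : ℕ → ℕ
  g i = f (+ i ℤ.- + N)
  inner : ∀ a b → a ℤ.- b ℤ.+ 1ℤ ≡ 1ℤ ℤ.+ a ℤ.- b
  inner = solve-∀
  g-ends : g (double N) ≡ g 0
  g-ends = begin
    f (+ double N ℤ.- + N)  ≡⟨ cong f (+double-+n N) ⟩
    f (+ N)                 ≡⟨ ends ⟨
    f (ℤ.- + N)             ≡⟨ cong f (ℤ.+-identityˡ (ℤ.- + N)) ⟨
    f (+ 0 ℤ.- + N)         ∎

record Interleaves (f g h : ℤ → ℕ) : Set where
  field
    at-twice   : ∀ k → f (twice k) ≡ g k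
    at-twice+1 : ∀ k → f (twice+1 k) ≡ h k

  left-of-twice : ∀ k → f (twice k ℤ.- 1ℤ) ≡ h (k ℤ.- 1ℤ)
  left-of-twice k = trans (cong f (twice-pred k)) (at-twice+1 (k ℤ.- 1ℤ))

  right-of-twice : ∀ k → f (twice k ℤ.+ 1ℤ) ≡ h k
  right-of-twice k = trans (cong f (twice-suc k)) (at-twice+1 k)

  left-of-twice+1 : ∀ k → f (twice+1 k ℤ.- 1ℤ) ≡ g k
  left-of-twice+1 k = trans (cong f (twice+1-pred k)) (at-twice k)

  right-of-twice+1 : ∀ k → f (twice+1 k ℤ.+ 1ℤ) ≡ g (k ℤ.+ 1ℤ)
  right-of-twice+1 k = trans (cong f (twice+1-suc k)) (at-twice (k ℤ.+ 1ℤ))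

window-interleave : ∀ N {f g h} → Interleaves f g h → window (double N) f ≡ window N g + window N h
window-interleave N {f} {g} {h} I = begin
  window (double N) f
    ≡⟨ sumTo-double (double N) (λ i → f (+ i ℤ.- + double N)) ⟩
  sumTo (double N) (λ i → f (+ double i ℤ.- + double N))
    + sumTo (double N) (λ i → f (+ suc (double i) ℤ.- + double N))
    ≡⟨ cong₂ _+_ (sumTo-cong (double N) (λ i → trans (cong f (even-cell i)) (at-twice (+ i ℤ.- + N))))
                 (sumTo-cong (double N) (λ i → trans (cong f (odd-cell i)) (at-twice+1 (+ i ℤ.- + N)))) ⟩
  window N g + window N h ∎
  where
  open Interleaves I
  diff : ∀ a b → a ℤ.+ a ℤ.- (b ℤ.+ b) ≡ a ℤ.- b ℤ.+ (a ℤ.- b)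
  diff = solve-∀
  diff+1 : ∀ a b → 1ℤ ℤ.+ (a ℤ.+ a) ℤ.- (b ℤ.+ b) ≡ 1ℤ ℤ.+ (a ℤ.- b ℤ.+ (a ℤ.- b))
  diff+1 = solve-∀
  even-cell : ∀ i → + double i ℤ.- + double N ≡ twice (+ i ℤ.- + N)
  even-cell i = trans (cong₂ ℤ._-_ (+double i) (+double N)) (diff (+ i) (+ N))
  odd-cell : ∀ i → + suc (double i) ℤ.- + double N ≡ twice+1 (+ i ℤ.- + N)
  odd-cell i = trans (cong₂ (λ a b → 1ℤ ℤ.+ a ℤ.- b) (+double i) (+double N)) (diff+1 (+ i) (+ N))

Dilation : (ℤ → ℕ) → (ℤ → ℕ) → Set
Dilation f g = Interleaves f g (const 0)

step : (ℤ → ℕ) → ℤ → ℕ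
step f n = (f (n ℤ.- 1ℤ) + f n + f (n ℤ.+ 1ℤ)) % 2

Δ : (ℤ → ℕ) → ℤ → ℕ
Δ f n = (f n + f (n ℤ.+ 1ℤ)) % 2

Binary : (ℤ → ℕ) → Set
Binary f = ∀ k → f k % 2 ≡ f k

step-at : ∀ f n {a b c} → f (n ℤ.- 1ℤ) ≡ a → f n ≡ b → f (n ℤ.+ 1ℤ) ≡ c →
          step f n ≡ (a + b + c) % 2
step-at f n refl refl refl = refl

Δ-at : ∀ f n {a b} → f n ≡ a → f (n ℤ.+ 1ℤ) ≡ b → Δ f n ≡ (a + b) % 2
Δ-at f n refl refl = refl

step-of-dilation : ∀ {f g} → Binary g → Dilation f g → Interleaves (step f) g (Δ g)
step-of-dilation {f} {g} g-binary I = record { at-twice = even ; at-twice+1 = odd }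
  where
  open Interleaves I
  even : ∀ k → step f (twice k) ≡ g k
  even k = begin
    step f (twice k)   ≡⟨ step-at f (twice k) (left-of-twice k) (at-twice k) (right-of-twice k) ⟩
    (g k + 0) % 2      ≡⟨ cong (_% 2) (+-identityʳ (g k)) ⟩
    g k % 2            ≡⟨ g-binary k ⟩
    g k                ∎
  odd : ∀ k → step f (twice+1 k) ≡ Δ g k
  odd k = begin
    step f (twice+1 k)
      ≡⟨ step-at f (twice+1 k) (left-of-twice+1 k) (at-twice+1 k) (right-of-twice+1 k) ⟩
    (g k + 0 + g (k ℤ.+ 1ℤ)) % 2
      ≡⟨ cong (λ a → (a + g (k ℤ.+ 1ℤ)) % 2) (+-identityʳ (g k)) ⟩
    Δ g k ∎

step-of-Δ-interleaving : ∀ {f g} → Interleaves f g (Δ g) → Dilation (step f) (step g)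
step-of-Δ-interleaving {f} {g} I = record { at-twice = even ; at-twice+1 = odd }
  where
  open Interleaves I
  pred-+1 : ∀ k → k ℤ.- 1ℤ ℤ.+ 1ℤ ≡ k
  pred-+1 = solve-∀
  even : ∀ k → step f (twice k) ≡ step g k
  even k = begin
    step f (twice k)
      ≡⟨ step-at f (twice k) (left-of-twice k) (at-twice k) (right-of-twice k) ⟩
    ((g (k ℤ.- 1ℤ) + g (k ℤ.- 1ℤ ℤ.+ 1ℤ)) % 2 + g k + Δ g k) % 2
      ≡⟨ cong (λ a → ((g (k ℤ.- 1ℤ) + g a) % 2 + g k + Δ g k) % 2) (pred-+1 k) ⟩
    ((g (k ℤ.- 1ℤ) + g k) % 2 + g k + Δ g k) % 2
      ≡⟨ [[l+m]%2+m+[m+n]%2]%2≡[l+m+n]%2 (g (k ℤ.- 1ℤ)) (g k) (g (k ℤ.+ 1ℤ)) ⟩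
    step g k ∎
  odd : ∀ k → step f (twice+1 k) ≡ 0
  odd k = begin
    step f (twice+1 k)
      ≡⟨ step-at f (twice+1 k) (left-of-twice+1 k) (at-twice+1 k) (right-of-twice+1 k) ⟩
    (g k + Δ g k + g (k ℤ.+ 1ℤ)) % 2
      ≡⟨ [m+[m+n]%2+n]%2≡0 (g k) (g (k ℤ.+ 1ℤ)) ⟩
    0 ∎

Δ-of-dilation : ∀ {f g} → Binary g → Dilation f g → Interleaves (Δ f) g (λ k → g (k ℤ.+ 1ℤ))
Δ-of-dilation {f} {g} g-binary I = record { at-twice = even ; at-twice+1 = odd }
  where
  open Interleaves I
  even : ∀ k → Δ f (twice k) ≡ g k
  even k = begin
    Δ f (twice k)  ≡⟨ Δ-at f (twice k) (at-twice k) (right-of-twice k) ⟩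
    (g k + 0) % 2  ≡⟨ cong (_% 2) (+-identityʳ (g k)) ⟩
    g k % 2        ≡⟨ g-binary k ⟩
    g k            ∎
  odd : ∀ k → Δ f (twice+1 k) ≡ g (k ℤ.+ 1ℤ)
  odd k = trans (Δ-at f (twice+1 k) (at-twice+1 k) (right-of-twice+1 k)) (g-binary (k ℤ.+ 1ℤ))

Δ-of-Δ-interleaving : ∀ {f g} → Binary g → Interleaves f g (Δ g) →
                      Interleaves (Δ f) (λ k → g (k ℤ.+ 1ℤ)) g
Δ-of-Δ-interleaving {f} {g} g-binary I = record { at-twice = even ; at-twice+1 = odd }
  where
  open Interleaves I
  even : ∀ k → Δ f (twice k) ≡ g (k ℤ.+ 1ℤ)
  even k = begin
    Δ f (twice k)              ≡⟨ Δ-at f (twice k) (at-twice k) (right-of-twice k) ⟩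
    (g k + Δ g k) % 2          ≡⟨ [m+[m+n]%2]%2≡n%2 (g k) (g (k ℤ.+ 1ℤ)) ⟩
    g (k ℤ.+ 1ℤ) % 2           ≡⟨ g-binary (k ℤ.+ 1ℤ) ⟩
    g (k ℤ.+ 1ℤ)               ∎
  odd : ∀ k → Δ f (twice+1 k) ≡ g k
  odd k = begin
    Δ f (twice+1 k)            ≡⟨ Δ-at f (twice+1 k) (at-twice+1 k) (right-of-twice+1 k) ⟩
    (Δ g k + g (k ℤ.+ 1ℤ)) % 2 ≡⟨ [[m+n]%2+n]%2≡m%2 (g k) (g (k ℤ.+ 1ℤ)) ⟩
    g k % 2                    ≡⟨ g-binary k ⟩
    g k                        ∎

row : ℕ → ℤ → ℕ
row t n = x n t

row-binary : ∀ t → Binary (row t)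
row-binary zero    (+ zero)  = refl
row-binary zero    (+ suc n) = refl
row-binary zero    -[1+ n ]  = refl
row-binary (suc t) n         = m%n%n≡m%n (row t (n ℤ.- 1ℤ) + row t n + row t (n ℤ.+ 1ℤ)) 2

∣k∣≤∣k+j∣+∣j∣ : ∀ k j → ∣ k ∣ ≤ ∣ k ℤ.+ j ∣ + ∣ j ∣
∣k∣≤∣k+j∣+∣j∣ k j =
  subst (λ i → ∣ i ∣ ≤ ∣ k ℤ.+ j ∣ + ∣ j ∣) (cancel k j) (∣i-j∣≤∣i∣+∣j∣ (k ℤ.+ j) j)
  where
  cancel : ∀ k j → k ℤ.+ j ℤ.- j ≡ k
  cancel = solve-∀

1+t<∣k∣⇒t<∣k+j∣ : ∀ {t} k j → ∣ j ∣ ≡ 1 → suc t < ∣ k ∣ → t < ∣ k ℤ.+ j ∣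
1+t<∣k∣⇒t<∣k+j∣ k j ∣j∣≡1 1+t<∣k∣ =
  s≤s⁻¹ (≤-trans 1+t<∣k∣ (≤-trans (∣k∣≤∣k+j∣+∣j∣ k j) (≤-reflexive ∣k+j∣+∣j∣≡1+∣k+j∣)))
  where
  ∣k+j∣+∣j∣≡1+∣k+j∣ : ∣ k ℤ.+ j ∣ + ∣ j ∣ ≡ suc (∣ k ℤ.+ j ∣)
  ∣k+j∣+∣j∣≡1+∣k+j∣ = trans (cong (λ n → ∣ k ℤ.+ j ∣ + n) ∣j∣≡1) (+-comm _ 1)

row-lightcone : ∀ t k → t < ∣ k ∣ → row t k ≡ 0
row-lightcone zero    (+ suc n) _       = refl
row-lightcone zero    -[1+ n ]  _       = refl
row-lightcone (suc t) k         t<∣k∣ =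
  step-at (row t) k (row-lightcone t (k ℤ.- 1ℤ) (1+t<∣k∣⇒t<∣k+j∣ k (ℤ.- 1ℤ) refl t<∣k∣))
                    (row-lightcone t k (<⇒≤ t<∣k∣))
                    (row-lightcone t (k ℤ.+ 1ℤ) (1+t<∣k∣⇒t<∣k+j∣ k 1ℤ refl t<∣k∣))

row-dilation : ∀ t → Dilation (row (double t)) (row t)
row-dilation zero    = record { at-twice = even ; at-twice+1 = odd }
  where
  even : ∀ k → row 0 (twice k) ≡ row 0 k
  even (+ zero)  = refl
  even (+ suc n) = refl
  even -[1+ n ]  = refl
  odd : ∀ k → row 0 (twice+1 k) ≡ 0
  odd (+ n)    = refl
  odd -[1+ n ] = refl
row-dilation (suc t) = step-of-Δ-interleaving (step-of-dilation (row-binary t) (row-dilation t))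

row-Δ-interleaving : ∀ t → Interleaves (row (suc (double t))) (row t) (Δ (row t))
row-Δ-interleaving t = step-of-dilation (row-binary t) (row-dilation t)

X≡window : ∀ s → X s ≡ window (suc s) (row s)
X≡window s = begin
  X s
    ≡⟨ cong (λ m → sumTo (suc m) (λ i → row s (+ i ℤ.- + s))) (sym (double≡2*n s)) ⟩
  window s (row s) + row s (+ double s ℤ.- + s)
    ≡⟨ cong (λ k → window s (row s) + row s k) (+double-+n s) ⟩
  window s (row s) + row s (+ s)
    ≡⟨ cong (λ a → a + window s (row s) + row s (+ s)) (row-lightcone s -[1+ s ] (n<1+n s)) ⟨
  row s -[1+ s ] + window s (row s) + row s (+ s)
    ≡⟨ window-suc s (row s) ⟨
  window (suc s) (row s) ∎

X≡wider-window : ∀ s → X s ≡ window (suc (suc s)) (row s)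
X≡wider-window s = trans (X≡window s) (sym (window-extend (suc s) (row s)
  (row-lightcone s -[1+ suc s ] (m<n⇒m<1+n (n<1+n s)))
  (row-lightcone s (+ suc s) (n<1+n s))))

X≡shifted-window : ∀ s → X s ≡ window (suc s) (λ k → row s (k ℤ.+ 1ℤ))
X≡shifted-window s = trans (X≡window s) (sym (window-shift (suc s) (row s)
  (trans (row-lightcone s -[1+ s ] (n<1+n s)) (sym (row-lightcone s (+ suc s) (n<1+n s))))))

B : ℕ → ℕ
B s = window (suc s) (Δ (row s))

B≡wider-window : ∀ s → B s ≡ window (suc (suc s)) (Δ (row s))
-- The neighbour -[1+ suc s ] ℤ.+ 1ℤ of the left end reduces to -[1+ s ].
B≡wider-window s = sym (window-extend (suc s) (Δ (row s))
  (Δ-at (row s) -[1+ suc s ] (row-lightcone s -[1+ suc s ] (m<n⇒m<1+n (n<1+n s)))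
                             (row-lightcone s -[1+ s ] (n<1+n s)))
  (Δ-at (row s) (+ suc s) (row-lightcone s (+ suc s) (n<1+n s))
                          (row-lightcone s (+ (suc s + 1)) (m≤m+n (suc s) 1))))

X-double : ∀ t → X (double t) ≡ X t
X-double t = begin
  X (double t)
    ≡⟨ X≡wider-window (double t) ⟩
  window (double (suc t)) (row (double t))
    ≡⟨ window-interleave (suc t) (row-dilation t) ⟩
  window (suc t) (row t) + window (suc t) (const 0)
    ≡⟨ cong (λ a → window (suc t) (row t) + a) (sumTo-zero (double (suc t))) ⟩
  window (suc t) (row t) + 0
    ≡⟨ +-identityʳ _ ⟩
  window (suc t) (row t)
    ≡⟨ X≡window t ⟨
  X t ∎

X-suc-double : ∀ t → X (suc (double t)) ≡ X t + B t
X-suc-double t = begin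
  X (suc (double t))                             ≡⟨ X≡window (suc (double t)) ⟩
  window (double (suc t)) (row (suc (double t))) ≡⟨ window-interleave (suc t) (row-Δ-interleaving t) ⟩
  window (suc t) (row t) + B t                   ≡⟨ cong (_+ B t) (X≡window t) ⟨
  X t + B t                                      ∎

B-double : ∀ t → B (double t) ≡ X t + X t
B-double t = begin
  B (double t)
    ≡⟨ B≡wider-window (double t) ⟩
  window (double (suc t)) (Δ (row (double t)))
    ≡⟨ window-interleave (suc t) (Δ-of-dilation (row-binary t) (row-dilation t)) ⟩
  window (suc t) (row t) + window (suc t) (λ k → row t (k ℤ.+ 1ℤ))
    ≡⟨ cong₂ _+_ (X≡window t) (X≡shifted-window t) ⟨
  X t + X t ∎

B-suc-double : ∀ t → B (suc (double t)) ≡ X t + X t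
B-suc-double t = begin
  B (suc (double t))
    ≡⟨ window-interleave (suc t) (Δ-of-Δ-interleaving (row-binary t) (row-Δ-interleaving t)) ⟩
  window (suc t) (λ k → row t (k ℤ.+ 1ℤ)) + window (suc t) (row t)
    ≡⟨ cong₂ _+_ (X≡shifted-window t) (X≡window t) ⟨
  X t + X t ∎

sumTo-2^suc : ∀ n (f : ℕ → ℕ) →
  sumTo (2 ^ suc n) f ≡ sumTo (2 ^ n) (λ i → f (double i)) + sumTo (2 ^ n) (λ i → f (suc (double i)))
sumTo-2^suc n f = trans (cong (λ m → sumTo m f) (sym (double≡2*n (2 ^ n)))) (sumTo-double (2 ^ n) f)

U : ℕ → ℕ
U n = sumTo (2 ^ n) B

S-suc : ∀ n → S (suc n) ≡ 2 * S n + U n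
S-suc n = begin
  S (suc n)
    ≡⟨ sumTo-2^suc n X ⟩
  sumTo (2 ^ n) (λ i → X (double i)) + sumTo (2 ^ n) (λ i → X (suc (double i)))
    ≡⟨ cong₂ _+_ (sumTo-cong (2 ^ n) X-double)
                 (trans (sumTo-cong (2 ^ n) X-suc-double) (sumTo-+ (2 ^ n) X B)) ⟩
  S n + (S n + U n)
    ≡⟨ rearrange (S n) (U n) ⟩
  2 * S n + U n ∎
  where
  rearrange : ∀ a b → a + (a + b) ≡ 2 * a + b
  rearrange = ℕ-Solver.solve-∀

U-suc : ∀ n → U (suc n) ≡ 4 * S n
U-suc n = begin
  U (suc n)
    ≡⟨ sumTo-2^suc n B ⟩
  sumTo (2 ^ n) (λ i → B (double i)) + sumTo (2 ^ n) (λ i → B (suc (double i)))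
    ≡⟨ cong₂ _+_ (trans (sumTo-cong (2 ^ n) B-double) (sumTo-+ (2 ^ n) X X))
                 (trans (sumTo-cong (2 ^ n) B-suc-double) (sumTo-+ (2 ^ n) X X)) ⟩
  S n + S n + (S n + S n)
    ≡⟨ rearrange (S n) ⟩
  4 * S n ∎
  where
  rearrange : ∀ a → a + a + (a + a) ≡ 4 * a
  rearrange = ℕ-Solver.solve-∀

mainTheorem4 : (S 0 ≡ 1) × (S 1 ≡ 4) × (∀ (n : ℕ) → S (2 + n) ≡ 2 * S (1 + n) + 4 * S n)
mainTheorem4 = refl , refl , λ n → begin
  S (2 + n)                  ≡⟨ S-suc (1 + n) ⟩
  2 * S (1 + n) + U (1 + n)  ≡⟨ cong (λ u → 2 * S (1 + n) + u) (U-suc n) ⟩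
  2 * S (1 + n) + 4 * S n    ∎
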